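{- Let $k$ be a positive integer, $G$ a $k$-edge-connected graph, and $X\subseteq V(G)$. Then the following are equivalent: (i) there is a partition $(X_1,\dots,X_t)$ of $X$ with $d_G(X_i)=k$ for all $i\in[t]$; (ii) for every $x\in X$ there exists a set $S_x\subseteq X$ with $x\in S_x$ and $d_G(S_x)=k$.
   Context: For $S\subseteq V(G)$, $d_G(S)$ denotes the number of edges of $G$ with exactly one endvertex in $S$ (graphs may have parallel edges). -}

module Defs where

open import Data.Nat using (ℕ; _≤_)
open import Data.Bool using (Bool; true; false; if_then_else_; _xor_)
open import Data.Fin using (Fin)
open import Data.Fin.Subset using (Subset; _∈_; _⊆_; ∁; Nonempty)
open import Data.Fin.Subset.Properties using (_∈?_)
open import Data.Vec using (lookup)
open import Data.List using (List; map; length; filter)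
open import Data.Nat.ListAction using (sum)
open import Data.List.Relation.Unary.All using (All)
open import Data.Product using (_×_; _,_)
open import Relation.Binary.PropositionalEquality using (_≡_)

-- A finite multigraph on vertex set Fin n: a list of edges (pairs of
-- endpoints).  Parallel edges are allowed (repeated list entries).
record Graph (n : ℕ) : Set where
  constructor graph
  field
    edges : List (Fin n × Fin n)
open Graph public

crosses : ∀ {n} → Subset n → Fin n × Fin n → Bool
crosses S (u , v) = lookup S u xor lookup S v

d : ∀ {n} → Graph n → Subset n → ℕ
d G S = sum (map (λ e → if crosses S e then 1 else 0) (edges G))

EdgeConnected : ∀ {n} → ℕ → Graph n → Set
EdgeConnected k G = ∀ S → Nonempty S → Nonempty (∁ S) → k ≤ d G S

countContaining : ∀ {n} → Fin n → List (Subset n) → ℕ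
countContaining v Ps = length (filter (λ P → v ∈? P) Ps)

IsPartition : ∀ {n} → Subset n → List (Subset n) → Set
IsPartition X Ps =
  All (λ P → Nonempty P × P ⊆ X) Ps × (∀ v → v ∈ X → countContaining v Ps ≡ 1)

-- Counting edge by edge, the cut function d is posimodular:
-- d (A ─ B) + d (B ─ A) ≤ d A + d B. In a k-edge-connected graph both
-- differences of two crossing tight sets (d = k) have cut at least k, so
-- posimodularity forces them to be tight as well. Hence the sets S_x can be
-- inserted one at a time into a disjoint family of tight subsets of X: a new
-- set S either lies inside a member, swallows a member, or is cut down to
-- S ─ P, which is again tight. The resulting family partitions X.
module Submission where

open import Defs
open import Data.Nat using (ℕ; _≤_; _+_; z≤n; s≤s)
open import Data.Nat.Properties
open import Data.Unit using (tt)
open import Data.Bool using (Bool; true; false; _∧_; not; _xor_; if_then_else_)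
open import Data.Bool.Properties using (∧-zeroʳ; ∧-identityʳ)
open import Data.Fin using (Fin; zero; suc)
open import Data.Fin.Subset using (Subset; _∈_; _∉_; _⊆_; _─_; Nonempty; Empty; inside; outside)
open import Data.Fin.Subset.Properties using (_∈?_; nonempty?; p─q⊆p; x∈p∧x∉q⇒x∈p─q; x∉p⇒x∈∁p)
open import Data.Vec using (_∷_; lookup)
import Data.Vec as Vec
open import Data.List using (List; []; _∷_; map; foldr; allFin)
open import Data.Nat.ListAction using (sum)
open import Data.List.Properties using (length-filter)
open import Data.List.Relation.Unary.All using (All; []; _∷_; zip; unzip; lookupAny)
open import Data.List.Relation.Unary.Any using (Any; here; there)
import Data.List.Membership.Propositional as List
open import Data.List.Membership.Propositional.Properties using (∈-allFin)
open import Data.Product using (_×_; _,_; ∃; proj₁; proj₂)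
open import Function using (_∘_)
open import Function.Bundles using (_⇔_; mk⇔)
open import Relation.Nullary using (yes; no; contradiction)
open import Relation.Binary.PropositionalEquality using (_≡_; refl; sym; cong₂; subst₂)
open import Algebra.Properties.CommutativeSemigroup +-commutativeSemigroup using (interchange)
open ≤-Reasoning

lookup-─ : ∀ {n} (p q : Subset n) i → lookup (p ─ q) i ≡ lookup p i ∧ not (lookup q i)
lookup-─ (x ∷ _) (inside  ∷ _) zero    = sym (∧-zeroʳ x)
lookup-─ (x ∷ _) (outside ∷ _) zero    = sym (∧-identityʳ x)
lookup-─ (_ ∷ p) (_ ∷ q)       (suc i) = lookup-─ p q i

x∈p─q⇒x∉q : ∀ {n} {x : Fin n} (p q : Subset n) → x ∈ p ─ q → x ∉ q
x∈p─q⇒x∉q (_ ∷ p) (_ ∷ q) (Vec.there x∈p─q) (Vec.there x∈q) = x∈p─q⇒x∉q p q x∈p─q x∈q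

Empty[p─q]⇒p⊆q : ∀ {n} {p q : Subset n} → Empty (p ─ q) → p ⊆ q
Empty[p─q]⇒p⊆q {q = q} p─q≡∅ {x} x∈p with x ∈? q
... | yes x∈q = x∈q
... | no  x∉q = contradiction (x , x∈p∧x∉q⇒x∈p─q x∈p x∉q) p─q≡∅

ind : Bool → ℕ
ind b = if b then 1 else 0

xor-─-posimodular : ∀ a₁ b₁ a₂ b₂ →
  ind ((a₁ ∧ not b₁) xor (a₂ ∧ not b₂)) + ind ((b₁ ∧ not a₁) xor (b₂ ∧ not a₂))
    ≤ ind (a₁ xor a₂) + ind (b₁ xor b₂)
xor-─-posimodular false false false false = ≤ᵇ⇒≤ _ _ tt
xor-─-posimodular false false false true  = ≤ᵇ⇒≤ _ _ tt
xor-─-posimodular false false true  false = ≤ᵇ⇒≤ _ _ tt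
xor-─-posimodular false false true  true  = ≤ᵇ⇒≤ _ _ tt
xor-─-posimodular false true  false false = ≤ᵇ⇒≤ _ _ tt
xor-─-posimodular false true  false true  = ≤ᵇ⇒≤ _ _ tt
xor-─-posimodular false true  true  false = ≤ᵇ⇒≤ _ _ tt
xor-─-posimodular false true  true  true  = ≤ᵇ⇒≤ _ _ tt
xor-─-posimodular true  false false false = ≤ᵇ⇒≤ _ _ tt
xor-─-posimodular true  false false true  = ≤ᵇ⇒≤ _ _ tt
xor-─-posimodular true  false true  false = ≤ᵇ⇒≤ _ _ tt
xor-─-posimodular true  false true  true  = ≤ᵇ⇒≤ _ _ tt
xor-─-posimodular true  true  false false = ≤ᵇ⇒≤ _ _ tt
xor-─-posimodular true  true  false true  = ≤ᵇ⇒≤ _ _ tt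
xor-─-posimodular true  true  true  false = ≤ᵇ⇒≤ _ _ tt
xor-─-posimodular true  true  true  true  = ≤ᵇ⇒≤ _ _ tt

crosses-posimodular : ∀ {n} (A B : Subset n) e →
  ind (crosses (A ─ B) e) + ind (crosses (B ─ A) e) ≤ ind (crosses A e) + ind (crosses B e)
crosses-posimodular A B (u , v)
  rewrite lookup-─ A B u | lookup-─ A B v | lookup-─ B A u | lookup-─ B A v =
  xor-─-posimodular (lookup A u) (lookup B u) (lookup A v) (lookup B v)

sum-map-≤₂ : ∀ {A : Set} (f g h j : A → ℕ) → (∀ x → f x + g x ≤ h x + j x) →
             ∀ xs → sum (map f xs) + sum (map g xs) ≤ sum (map h xs) + sum (map j xs)
sum-map-≤₂ f g h j pointwise []       = z≤n
sum-map-≤₂ f g h j pointwise (x ∷ xs) =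
  subst₂ _≤_ (interchange (f x) (g x) (sum (map f xs)) (sum (map g xs)))
             (interchange (h x) (j x) (sum (map h xs)) (sum (map j xs)))
             (+-mono-≤ (pointwise x) (sum-map-≤₂ f g h j pointwise xs))

d-posimodular : ∀ {n} (G : Graph n) (A B : Subset n) → d G (A ─ B) + d G (B ─ A) ≤ d G A + d G B
d-posimodular G A B =
  sum-map-≤₂ (ind ∘ crosses (A ─ B)) (ind ∘ crosses (B ─ A)) (ind ∘ crosses A) (ind ∘ crosses B)
             (crosses-posimodular A B) (edges G)

module _ {n k} (G : Graph n) (k-connected : EdgeConnected k G) where

  crossing-cut-≥ : ∀ {A B} → Nonempty (A ─ B) → Nonempty (B ─ A) → k ≤ d G (A ─ B)
  crossing-cut-≥ {A} {B} A─B≢∅ (x , x∈B─A) =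
    k-connected _ A─B≢∅ (x , x∉p⇒x∈∁p (x∈p─q⇒x∉q B A x∈B─A ∘ p─q⊆p A B))

  tight-─ : ∀ {S P} → d G S ≡ k → d G P ≡ k → Nonempty (S ─ P) → Nonempty (P ─ S) → d G (S ─ P) ≡ k
  tight-─ {S} {P} dS≡k dP≡k S─P≢∅ P─S≢∅ = ≤-antisym upper (crossing-cut-≥ S─P≢∅ P─S≢∅)
    where
    upper : d G (S ─ P) ≤ k
    upper = +-cancelʳ-≤ k _ _ (begin
      d G (S ─ P) + k            ≤⟨ +-monoʳ-≤ (d G (S ─ P)) (crossing-cut-≥ P─S≢∅ S─P≢∅) ⟩
      d G (S ─ P) + d G (P ─ S)  ≤⟨ d-posimodular G S P ⟩
      d G S + d G P              ≡⟨ cong₂ _+_ dS≡k dP≡k ⟩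
      k + k                      ∎)

insert : ∀ {n} → Subset n → List (Subset n) → List (Subset n)
insert S []       = S ∷ []
insert S (P ∷ Ps) with nonempty? (S ─ P) | nonempty? (P ─ S)
... | no  _ | _     = P ∷ Ps
... | yes _ | no  _ = insert S Ps
... | yes _ | yes _ = P ∷ insert (S ─ P) Ps

uncross : ∀ {n} → List (Subset n) → List (Subset n)
uncross = foldr insert []

module _ {n} {Q : Subset n → Set} (Q-─ : ∀ {S P} → Q S → Q P → Nonempty (S ─ P) → Nonempty (P ─ S) → Q (S ─ P)) where

  insert-All : ∀ {S Ps} → Q S → All Q Ps → All Q (insert S Ps)
  insert-All {S} {[]}     qS []         = qS ∷ []
  insert-All {S} {P ∷ Ps} qS (qP ∷ qPs) with nonempty? (S ─ P) | nonempty? (P ─ S)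
  ... | no  _     | _         = qP ∷ qPs
  ... | yes _     | no  _     = insert-All qS qPs
  ... | yes S─P≢∅ | yes P─S≢∅ = qP ∷ insert-All (Q-─ qS qP S─P≢∅ P─S≢∅) qPs

  uncross-All : ∀ {Ss} → All Q Ss → All Q (uncross Ss)
  uncross-All []         = []
  uncross-All (qS ∷ qSs) = insert-All qS (uncross-All qSs)

module _ {n} {v : Fin n} where

  insert-covers : ∀ S Ps → v ∈ S → Any (v ∈_) (insert S Ps)
  insert-covers S []       v∈S = here v∈S
  insert-covers S (P ∷ Ps) v∈S with nonempty? (S ─ P) | nonempty? (P ─ S)
  ... | no  S─P≡∅ | _     = here (Empty[p─q]⇒p⊆q S─P≡∅ v∈S)
  ... | yes _     | no  _ = insert-covers S Ps v∈S
  ... | yes _     | yes _ with v ∈? P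
  ...   | yes v∈P = here v∈P
  ...   | no  v∉P = there (insert-covers (S ─ P) Ps (x∈p∧x∉q⇒x∈p─q v∈S v∉P))

  insert-keeps : ∀ S Ps → Any (v ∈_) Ps → Any (v ∈_) (insert S Ps)
  insert-keeps S (P ∷ Ps) v∈⋃Ps with nonempty? (S ─ P) | nonempty? (P ─ S) | v∈⋃Ps
  ... | no  _ | _         | _            = v∈⋃Ps
  ... | yes _ | no  P─S≡∅ | here v∈P     = insert-covers S Ps (Empty[p─q]⇒p⊆q P─S≡∅ v∈P)
  ... | yes _ | no  _     | there v∈⋃Ps′ = insert-keeps S Ps v∈⋃Ps′
  ... | yes _ | yes _     | here v∈P     = here v∈P
  ... | yes _ | yes _     | there v∈⋃Ps′ = there (insert-keeps (S ─ P) Ps v∈⋃Ps′)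

  count : List (Subset n) → ℕ
  count = countContaining v

  count-≤-∷ : ∀ P Ps → count Ps ≤ count (P ∷ Ps)
  count-≤-∷ P Ps with v ∈? P
  ... | yes _ = n≤1+n _
  ... | no  _ = ≤-refl

  count-∷-mono : ∀ P {Ps Qs} → count Ps ≤ count Qs → count (P ∷ Ps) ≤ count (P ∷ Qs)
  count-∷-mono P h with v ∈? P
  ... | yes _ = s≤s h
  ... | no  _ = h

  count-insert-∉ : ∀ S Ps → v ∉ S → count (insert S Ps) ≤ count Ps
  count-insert-∉ S []       v∉S with v ∈? S
  ... | yes v∈S = contradiction v∈S v∉S
  ... | no  _   = z≤n
  count-insert-∉ S (P ∷ Ps) v∉S with nonempty? (S ─ P) | nonempty? (P ─ S)
  ... | no  _ | _     = ≤-refl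
  ... | yes _ | no  _ = ≤-trans (count-insert-∉ S Ps v∉S) (count-≤-∷ P Ps)
  ... | yes _ | yes _ = count-∷-mono P (count-insert-∉ (S ─ P) Ps (v∉S ∘ p─q⊆p S P))

  count-insert-≤1 : ∀ S Ps → count Ps ≤ 1 → count (insert S Ps) ≤ 1
  count-insert-≤1 S []       _ = length-filter (v ∈?_) (S ∷ [])
  count-insert-≤1 S (P ∷ Ps) h with nonempty? (S ─ P) | nonempty? (P ─ S)
  ... | no  _ | _     = h
  ... | yes _ | no  _ = count-insert-≤1 S Ps (≤-trans (count-≤-∷ P Ps) h)
  ... | yes _ | yes _ with v ∈? P
  ...   | yes v∈P = ≤-trans (s≤s (count-insert-∉ (S ─ P) Ps (λ v∈S─P → x∈p─q⇒x∉q S P v∈S─P v∈P))) h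
  ...   | no  _   = count-insert-≤1 (S ─ P) Ps h

  uncross-covers : ∀ Ss → Any (v ∈_) Ss → Any (v ∈_) (uncross Ss)
  uncross-covers (S ∷ Ss) (here v∈S)   = insert-covers S (uncross Ss) v∈S
  uncross-covers (S ∷ Ss) (there v∈⋃Ss) = insert-keeps S (uncross Ss) (uncross-covers Ss v∈⋃Ss)

  count-uncross-≤1 : ∀ Ss → count (uncross Ss) ≤ 1
  count-uncross-≤1 []       = z≤n
  count-uncross-≤1 (S ∷ Ss) = count-insert-≤1 S (uncross Ss) (count-uncross-≤1 Ss)

  Any⇒1≤count : ∀ Ps → Any (v ∈_) Ps → 1 ≤ count Ps
  Any⇒1≤count (P ∷ Ps) v∈⋃Ps with v ∈? P | v∈⋃Ps
  ... | yes _   | _             = s≤s z≤n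
  ... | no  v∉P | here v∈P      = contradiction v∈P v∉P
  ... | no  _   | there v∈⋃Ps′ = Any⇒1≤count Ps v∈⋃Ps′

  1≤count⇒Any : ∀ Ps → 1 ≤ count Ps → Any (v ∈_) Ps
  1≤count⇒Any (P ∷ Ps) 1≤count with v ∈? P
  ... | yes v∈P = here v∈P
  ... | no  _   = there (1≤count⇒Any Ps 1≤count)

TightIn : ∀ {n} → Graph n → ℕ → Subset n → Subset n → Set
TightIn G k X S = (Nonempty S × S ⊆ X) × d G S ≡ k

module _ {n k} (G : Graph n) (k-connected : EdgeConnected k G) (X : Subset n) where

  TightIn-─ : ∀ {S P} → TightIn G k X S → TightIn G k X P → Nonempty (S ─ P) → Nonempty (P ─ S) →
              TightIn G k X (S ─ P)
  TightIn-─ {S} {P} ((_ , S⊆X) , dS≡k) (_ , dP≡k) S─P≢∅ P─S≢∅ =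
    (S─P≢∅ , S⊆X ∘ p─q⊆p S P) , tight-─ G k-connected dS≡k dP≡k S─P≢∅ P─S≢∅

  uncross-IsPartition : ∀ Ss → All (TightIn G k X) Ss → (∀ v → v ∈ X → Any (v ∈_) Ss) →
                        IsPartition X (uncross Ss) × All (λ P → d G P ≡ k) (uncross Ss)
  uncross-IsPartition Ss tightSs covers = (blocks , exactly-once) , tight
    where
    blocks = proj₁ (unzip (uncross-All TightIn-─ tightSs))
    tight  = proj₂ (unzip (uncross-All TightIn-─ tightSs))
    exactly-once : ∀ v → v ∈ X → countContaining v (uncross Ss) ≡ 1
    exactly-once v v∈X =
      ≤-antisym (count-uncross-≤1 Ss) (Any⇒1≤count _ (uncross-covers Ss (covers v v∈X)))

module _ {n k} (G : Graph n) (X : Subset n)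
         (cover : ∀ x → x ∈ X → ∃ λ S → S ⊆ X × x ∈ S × d G S ≡ k) where

  witnesses : List (Fin n) → List (Subset n)
  witnesses []       = []
  witnesses (x ∷ xs) with x ∈? X
  ... | yes x∈X = proj₁ (cover x x∈X) ∷ witnesses xs
  ... | no  _   = witnesses xs

  witnesses-tight : ∀ xs → All (TightIn G k X) (witnesses xs)
  witnesses-tight []       = []
  witnesses-tight (x ∷ xs) with x ∈? X
  ... | yes x∈X = let (_ , S⊆X , x∈S , dS≡k) = cover x x∈X
                  in (((x , x∈S) , S⊆X) , dS≡k) ∷ witnesses-tight xs
  ... | no  _   = witnesses-tight xs

  witnesses-cover : ∀ {v} xs → v List.∈ xs → v ∈ X → Any (v ∈_) (witnesses xs)
  witnesses-cover (x ∷ xs) v∈xs v∈X with x ∈? X | v∈xs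
  ... | yes x∈X | here refl    = let (_ , _ , x∈S , _) = cover x x∈X in here x∈S
  ... | yes _   | there v∈xs′ = there (witnesses-cover xs v∈xs′ v∈X)
  ... | no  x∉X | here refl    = contradiction v∈X x∉X
  ... | no  _   | there v∈xs′ = witnesses-cover xs v∈xs′ v∈X

partition⇒cover : ∀ {n k} (G : Graph n) {X Ps} → IsPartition X Ps → All (λ P → d G P ≡ k) Ps →
                  ∀ x → x ∈ X → ∃ λ S → S ⊆ X × x ∈ S × d G S ≡ k
partition⇒cover G {Ps = Ps} (blocks , exactly-once) tight x x∈X
  with lookupAny (zip (blocks , tight)) (1≤count⇒Any {v = x} Ps (≤-reflexive (sym (exactly-once x x∈X))))
... | ((_ , P⊆X) , dP≡k) , x∈P = _ , P⊆X , x∈P , dP≡k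

mainTheorem14 : ∀ {n} (k : ℕ) (G : Graph n) → 1 ≤ k → EdgeConnected k G → (X : Subset n) →
    (∃ λ (Ps : List (Subset n)) → IsPartition X Ps × All (λ P → d G P ≡ k) Ps)
    ⇔ (∀ (x : Fin n) → x ∈ X → ∃ λ (S : Subset n) → S ⊆ X × x ∈ S × d G S ≡ k)
-- The argument does not use k ≥ 1.
mainTheorem14 {n} k G _ k-connected X =
  mk⇔ (λ (Ps , partition , tight) → partition⇒cover G partition tight) cover⇒partition
  where
  cover⇒partition : (∀ x → x ∈ X → ∃ λ S → S ⊆ X × x ∈ S × d G S ≡ k) →
                    ∃ λ Ps → IsPartition X Ps × All (λ P → d G P ≡ k) Ps
  cover⇒partition cover = uncross Ss , uncross-IsPartition G k-connected X Ss
    (witnesses-tight G X cover (allFin n))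
    (λ v v∈X → witnesses-cover G X cover (allFin n) (∈-allFin v) v∈X)
    where Ss = witnesses G X cover (allFin n)
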